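{- Let $G$ be a finite abelian group and $S$ an inverse-closed generating subset of $G$ with $1\notin S$; let $k=|S|$. If $\mathrm{Cay}(G,S)$ admits an $(a,b)$-perfect set $W_1$, where $0\le a\le k-1$ and $1\le b\le k$, then the multiplicity of $a-b$ as an eigenvalue of $\mathrm{Cay}(G,S)$ is at least $r-1$, where $r$ is the rank of the set of vectors $\{\mathbf{1}_{W_1x}:x\in G\}$ in $\mathbb{C}^G$.
   Context: $\mathrm{Cay}(G,S)$ has vertex set $G$ with $x,y$ adjacent iff $yx^{ -1}\in S$; it is $|S|$-regular. A nonempty proper subset $W_1$ of the vertex set of a $k$-regular graph is an $(a,b)$-perfect set if every vertex of $W_1$ has exactly $a$ neighbours in $W_1$ and every vertex outside $W_1$ has exactly $b$ neighbours in $W_1$. $\mathbf{1}_X$ is the characteristic vector of $X$ and $W_1x=\{wx:w\in W_1\}$. -}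

module Defs where

open import Data.Nat using (ℕ; zero; suc)
import Data.Nat as ℕ
open import Data.Bool using (Bool; true; false; if_then_else_; _∧_)
open import Data.Fin using (Fin)
import Data.Fin as F
open import Data.Product using (Σ; ∃; _×_; _,_)
open import Data.List using (List; foldr)
open import Data.List.Relation.Unary.All using (All)
open import Data.Rational using (ℚ; 0ℚ; 1ℚ; _+_; _*_; _-_)
open import Data.Integer using (+_)
import Data.Rational as ℚ
open import Relation.Binary.PropositionalEquality using (_≡_; _≢_)
open import Relation.Nullary using (¬_)
open import Function.Definitions using (Injective)
open import Algebra.Structures using (IsAbelianGroup)

-- A finite abelian group, with carrier Fin n (every finite abelian group of
-- order n is isomorphic to one of this form), equality propositional.
record FinAbelianGroup (n : ℕ) : Set where
  field
    _∙_ : Fin n → Fin n → Fin n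
    ε   : Fin n
    _⁻¹ : Fin n → Fin n
    isAbelianGroup : IsAbelianGroup _≡_ _∙_ ε _⁻¹

ΣFin : (n : ℕ) → (Fin n → ℚ) → ℚ
ΣFin zero    f = 0ℚ
ΣFin (suc n) f = f F.zero + ΣFin n (λ i → f (F.suc i))

count : (n : ℕ) → (Fin n → Bool) → ℕ
count zero    P = 0
count (suc n) P = (if P F.zero then 1 else 0) ℕ.+ count n (λ i → P (F.suc i))

ℕtoℚ : ℕ → ℚ
ℕtoℚ k = (+ k) ℚ./ 1

boolToℚ : Bool → ℚ
boolToℚ true  = 1ℚ
boolToℚ false = 0ℚ

Vecℚ : ℕ → Set
Vecℚ n = Fin n → ℚ

LinIndep : {n m : ℕ} → (Fin m → Vecℚ n) → Set
LinIndep {n} {m} w =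
  (c : Fin m → ℚ) → (∀ j → ΣFin m (λ i → c i * w i j) ≡ 0ℚ) → ∀ i → c i ≡ 0ℚ

HasIndepSubfamily : {n : ℕ} {I : Set} → (I → Vecℚ n) → ℕ → Set
HasIndepSubfamily {n} {I} v m =
  Σ (Fin m → I) λ f → Injective _≡_ _≡_ f × LinIndep (λ i → v (f i))

IsRank : {n : ℕ} {I : Set} → (I → Vecℚ n) → ℕ → Set
IsRank v r = HasIndepSubfamily v r × ¬ HasIndepSubfamily v (suc r)

module Cayley {n : ℕ} (G : FinAbelianGroup n) where
  open FinAbelianGroup G

  InverseClosed : (Fin n → Bool) → Set
  InverseClosed S = ∀ x → S (x ⁻¹) ≡ S x

  Generates : (Fin n → Bool) → Set
  Generates S = ∀ g → Σ (List (Fin n)) λ xs →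
    All (λ s → S s ≡ true) xs × foldr _∙_ ε xs ≡ g

  adj : (Fin n → Bool) → Fin n → Fin n → Bool
  adj S x y = S (y ∙ (x ⁻¹))

  A : (Fin n → Bool) → Fin n → Fin n → ℚ
  A S x y = boolToℚ (adj S x y)

  nbrsIn : (Fin n → Bool) → (Fin n → Bool) → Fin n → ℕ
  nbrsIn S W x = count n (λ y → adj S x y ∧ W y)

  IsPerfectSet : (Fin n → Bool) → (Fin n → Bool) → ℕ → ℕ → Set
  IsPerfectSet S W a b =
    (∃ λ w → W w ≡ true) × (∃ λ w → W w ≡ false) ×
    (∀ x → W x ≡ true → nbrsIn S W x ≡ a) ×
    (∀ x → W x ≡ false → nbrsIn S W x ≡ b)

  -- characteristic vector of the translate W x = { w x : w ∈ W }
  -- (y ∈ W x iff y x⁻¹ ∈ W)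
  indTranslate : (Fin n → Bool) → Fin n → Vecℚ n
  indTranslate W x y = boolToℚ (W (y ∙ (x ⁻¹)))

  IsEigenvector : (Fin n → Bool) → ℚ → Vecℚ n → Set
  IsEigenvector S λ' v = ∀ x → ΣFin n (λ y → A S x y * v y) ≡ λ' * v x

  -- multiplicity of λ as an eigenvalue is at least m: the eigenspace contains
  -- m linearly independent vectors (A is symmetric, so geometric = algebraic
  -- multiplicity)
  MultiplicityAtLeast : (Fin n → Bool) → ℚ → ℕ → Set
  MultiplicityAtLeast S λ' m =
    Σ (Fin m → Vecℚ n) λ v → LinIndep v × (∀ i → IsEigenvector S λ' (v i))

{-# OPTIONS --safe #-}
-- Right translation u ↦ u z is an automorphism of Cay(G,S) mapping W₁ onto W₁z,
-- so a vertex x has as many neighbours in W₁z as x z⁻¹ has in W₁, namely a or b.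
-- Hence A 𝟏_{W₁z} = (a - b) 𝟏_{W₁z} + b 𝟏 for every z, and the difference of two
-- such vectors is an eigenvector for a - b. If 𝟏_{W₁z₀}, …, 𝟏_{W₁zₘ} are linearly
-- independent, then so are the m differences 𝟏_{W₁zᵢ} - 𝟏_{W₁z₀}.
module Submission where

open import Defs
open import Data.Nat using (ℕ; zero; suc; _≤_; _<_; _∸_)
open import Data.Bool using (Bool; true; false; _∧_)
open import Data.Fin using (Fin; zero; suc)
open import Data.Fin.Permutation using (Permutation; permutation; _⟨$⟩ʳ_)
open import Data.Vec.Functional using (_∷_; map)
open import Data.Product using (_,_)
open import Function using (_∘_)
open import Data.Integer using (+_)
import Data.Integer as ℤ
import Data.Integer.Properties as ℤ
open import Data.Rational using (ℚ; 0ℚ; 1ℚ; _+_; _*_; -_; _-_; toℚᵘ)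
open import Data.Rational.Properties
  using (+-*-ring; toℚᵘ-injective; toℚᵘ-fromℚᵘ; toℚᵘ-homo-+; +-identityˡ; +-comm; neg-distribˡ-*)
import Data.Rational.Unnormalised as ℚᵘ
import Data.Rational.Unnormalised.Properties as ℚᵘ
open import Data.Rational.Solver using (module +-*-Solver)
open import Algebra.Bundles using (Ring; Group)
open import Algebra.Structures using (IsAbelianGroup)
import Algebra.Properties.Semiring.Sum as SemiringSum
import Algebra.Properties.Group as GroupProperties
open import Relation.Binary.PropositionalEquality
  using (_≡_; refl; sym; trans; cong; cong₂; module ≡-Reasoning)

open SemiringSum (Ring.semiring +-*-ring) using (sum; sum-permute; *-distribʳ-sum)

-- ℕtoℚ k unfolds to fromℚᵘ (mkℚᵘ (+ k) 0), so the identity is checked in ℚᵘ.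
ℕtoℚ-suc : ∀ k → ℕtoℚ (suc k) ≡ 1ℚ + ℕtoℚ k
ℕtoℚ-suc k = toℚᵘ-injective (begin
  toℚᵘ (ℕtoℚ (suc k))                 ≈⟨ toℚᵘ-fromℚᵘ (ℚᵘ.mkℚᵘ (+ suc k) 0) ⟩
  ℚᵘ.mkℚᵘ (+ suc k) 0                  ≈⟨ ℚᵘ.*≡* numerators-agree ⟩
  ℚᵘ.1ℚᵘ ℚᵘ.+ ℚᵘ.mkℚᵘ (+ k) 0          ≈⟨ ℚᵘ.+-congʳ ℚᵘ.1ℚᵘ (toℚᵘ-fromℚᵘ (ℚᵘ.mkℚᵘ (+ k) 0)) ⟨
  toℚᵘ 1ℚ ℚᵘ.+ toℚᵘ (ℕtoℚ k)           ≈⟨ toℚᵘ-homo-+ 1ℚ (ℕtoℚ k) ⟨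
  toℚᵘ (1ℚ + ℕtoℚ k)                  ∎)
  where
  open ℚᵘ.≃-Reasoning
  numerators-agree : + suc k ℤ.* + 1 ≡ (+ 1 ℤ.+ + k ℤ.* + 1) ℤ.* + 1
  numerators-agree = trans (ℤ.*-identityʳ (+ suc k))
    (sym (trans (ℤ.*-identityʳ _) (cong (ℤ._+_ ℤ.1ℤ) (ℤ.*-identityʳ (+ k)))))

ΣFin-cong : ∀ n {f g : Fin n → ℚ} → (∀ i → f i ≡ g i) → ΣFin n f ≡ ΣFin n g
ΣFin-cong zero    f≗g = refl
ΣFin-cong (suc n) f≗g = cong₂ _+_ (f≗g zero) (ΣFin-cong n (f≗g ∘ suc))

ΣFin≡sum : ∀ n (f : Fin n → ℚ) → ΣFin n f ≡ sum f
ΣFin≡sum zero    f = refl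
ΣFin≡sum (suc n) f = cong (_+_ (f zero)) (ΣFin≡sum n (f ∘ suc))

ΣFin-permute : ∀ n (f : Fin n → ℚ) (π : Permutation n n) →
               ΣFin n f ≡ ΣFin n (λ i → f (π ⟨$⟩ʳ i))
ΣFin-permute n f π = begin
  ΣFin n f                         ≡⟨ ΣFin≡sum n f ⟩
  sum f                            ≡⟨ sum-permute f π ⟩
  sum (λ i → f (π ⟨$⟩ʳ i))         ≡⟨ ΣFin≡sum n _ ⟨
  ΣFin n (λ i → f (π ⟨$⟩ʳ i))      ∎
  where open ≡-Reasoning

ΣFin-*ʳ : ∀ n (f : Fin n → ℚ) q → ΣFin n (λ i → f i * q) ≡ ΣFin n f * q
ΣFin-*ʳ n f q = begin
  ΣFin n (λ i → f i * q)   ≡⟨ ΣFin≡sum n _ ⟩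
  sum (map (_* q) f)       ≡⟨ *-distribʳ-sum q f ⟨
  sum f * q                ≡⟨ cong (_* q) (ΣFin≡sum n f) ⟨
  ΣFin n f * q             ∎
  where open ≡-Reasoning

ΣFin-*-distrib-sub : ∀ n (p f g : Fin n → ℚ) →
  ΣFin n (λ i → p i * (f i - g i)) ≡ ΣFin n (λ i → p i * f i) - ΣFin n (λ i → p i * g i)
ΣFin-*-distrib-sub zero    p f g = refl
ΣFin-*-distrib-sub (suc n) p f g =
  trans (cong (_+_ (p zero * (f zero - g zero)))
              (ΣFin-*-distrib-sub n (p ∘ suc) (f ∘ suc) (g ∘ suc)))
        (solve 5 (λ p f g x y → p :* (f :- g) :+ (x :- y) := (p :* f :+ x) :- (p :* g :+ y))
               refl (p zero) (f zero) (g zero) _ _)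
  where open +-*-Solver

ΣFin-boolToℚ : ∀ n (P : Fin n → Bool) → ΣFin n (λ i → boolToℚ (P i)) ≡ ℕtoℚ (count n P)
ΣFin-boolToℚ zero    P = refl
ΣFin-boolToℚ (suc n) P with P zero
... | true  = trans (cong (_+_ 1ℚ) (ΣFin-boolToℚ n (P ∘ suc))) (sym (ℕtoℚ-suc (count n (P ∘ suc))))
... | false = trans (+-identityˡ _) (ΣFin-boolToℚ n (P ∘ suc))

boolToℚ-∧ : ∀ p q → boolToℚ p * boolToℚ q ≡ boolToℚ (p ∧ q)
boolToℚ-∧ true  true  = refl
boolToℚ-∧ true  false = refl
boolToℚ-∧ false true  = refl
boolToℚ-∧ false false = refl

_-ᵛ_ : ∀ {n} → Vecℚ n → Vecℚ n → Vecℚ n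
(v -ᵛ w) i = v i - w i

LinIndep-differences : ∀ {n m} (w : Fin (suc m) → Vecℚ n) → LinIndep w →
                       LinIndep (λ i → w (suc i) -ᵛ w zero)
-- Σ cᵢ (wᵢ₊₁ - w₀) is the combination of the w with coefficients (- Σ c) ∷ c.
LinIndep-differences {n} {m} w indep c combination≡0 i =
  indep ((- ΣFin m c) ∷ c) extended≡0 (suc i)
  where
  open ≡-Reasoning
  extended≡0 : ∀ j → ΣFin (suc m) (λ k → ((- ΣFin m c) ∷ c) k * w k j) ≡ 0ℚ
  extended≡0 j = begin
    - C * q + P                                   ≡⟨ +-comm (- C * q) P ⟩
    P + - C * q                                   ≡⟨ cong (_+_ P) (neg-distribˡ-* C q) ⟨
    P - C * q                                     ≡⟨ cong (_-_ P) (ΣFin-*ʳ m c q) ⟨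
    P - ΣFin m (λ k → c k * q)                    ≡⟨ ΣFin-*-distrib-sub m c (λ k → w (suc k) j) (λ _ → q) ⟨
    ΣFin m (λ k → c k * (w (suc k) -ᵛ w zero) j)  ≡⟨ combination≡0 j ⟩
    0ℚ                                            ∎
    where
    C = ΣFin m c
    q = w zero j
    P = ΣFin m (λ k → c k * w (suc k) j)

_·ᵛ_ : ∀ {n} → (Fin n → Fin n → ℚ) → Vecℚ n → Vecℚ n
_·ᵛ_ {n} M v x = ΣFin n (λ y → M x y * v y)

IsAffineEigenvector : ∀ {n} → (Fin n → Fin n → ℚ) → ℚ → ℚ → Vecℚ n → Set
IsAffineEigenvector M λ' c v = ∀ x → (M ·ᵛ v) x ≡ λ' * v x + c

IsAffineEigenvector-sub : ∀ {n} (M : Fin n → Fin n → ℚ) λ' c {v w : Vecℚ n} →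
  IsAffineEigenvector M λ' c v → IsAffineEigenvector M λ' c w →
  ∀ x → (M ·ᵛ (v -ᵛ w)) x ≡ λ' * (v -ᵛ w) x
IsAffineEigenvector-sub {n} M λ' c {v} {w} Mv Mw x = begin
  (M ·ᵛ (v -ᵛ w)) x                    ≡⟨ ΣFin-*-distrib-sub n (M x) v w ⟩
  (M ·ᵛ v) x - (M ·ᵛ w) x              ≡⟨ cong₂ _-_ (Mv x) (Mw x) ⟩
  (λ' * v x + c) - (λ' * w x + c)      ≡⟨ cancel-c λ' (v x) (w x) c ⟩
  λ' * (v x - w x)                     ∎
  where
  open ≡-Reasoning
  open +-*-Solver
  cancel-c : ∀ l p q c → (l * p + c) - (l * q + c) ≡ l * (p - q)
  cancel-c = solve 4 (λ l p q c → (l :* p :+ c) :- (l :* q :+ c) := l :* (p :- q)) refl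

module _ {n} (G : FinAbelianGroup n) where
  open FinAbelianGroup G
  open Cayley G

  private
    group : Group _ _
    group = record { isGroup = IsAbelianGroup.isGroup isAbelianGroup }
  open Group group using (_//_; assoc)
  open GroupProperties group using (//-rightDividesˡ; //-rightDividesʳ; ⁻¹-anti-homo-//)

  rightTranslation : Fin n → Permutation n n
  rightTranslation z = permutation (_∙ z) (_// z) (//-rightDividesˡ z) (//-rightDividesʳ z)

  adj-rightTranslation : ∀ S x z u → adj S x (u ∙ z) ≡ adj S (x // z) u
  adj-rightTranslation S x z u =
    cong S (trans (assoc u z (x ⁻¹)) (cong (u ∙_) (sym (⁻¹-anti-homo-// x z))))

  A·indTranslate : ∀ S W z x → (A S ·ᵛ indTranslate W z) x ≡ ℕtoℚ (nbrsIn S W (x // z))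
  A·indTranslate S W z x = begin
    ΣFin n (λ y → A S x y * indTranslate W z y)              ≡⟨ ΣFin-permute n _ (rightTranslation z) ⟩
    ΣFin n (λ u → A S x (u ∙ z) * indTranslate W z (u ∙ z))  ≡⟨ ΣFin-cong n translated ⟩
    ΣFin n (λ u → boolToℚ (adj S (x // z) u ∧ W u))          ≡⟨ ΣFin-boolToℚ n _ ⟩
    ℕtoℚ (nbrsIn S W (x // z))                                ∎
    where
    open ≡-Reasoning
    translated : ∀ u → A S x (u ∙ z) * indTranslate W z (u ∙ z) ≡ boolToℚ (adj S (x // z) u ∧ W u)
    translated u = trans (cong₂ (λ s w → boolToℚ s * boolToℚ (W w))
                                (adj-rightTranslation S x z u) (//-rightDividesʳ z u))
                         (boolToℚ-∧ (adj S (x // z) u) (W u))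

  indTranslate-affineEigenvector : ∀ S W a b → IsPerfectSet S W a b →
    ∀ z → IsAffineEigenvector (A S) (ℕtoℚ a - ℕtoℚ b) (ℕtoℚ b) (indTranslate W z)
  indTranslate-affineEigenvector S W a b (_ , _ , inside , outside) z x
    with W (x // z) in x/z∈W
  ... | true  = trans (A·indTranslate S W z x) (trans (cong ℕtoℚ (inside _ x/z∈W))
                  (solve 2 (λ a b → a := (a :- b) :* con 1ℚ :+ b) refl (ℕtoℚ a) (ℕtoℚ b)))
    where open +-*-Solver
  ... | false = trans (A·indTranslate S W z x) (trans (cong ℕtoℚ (outside _ x/z∈W))
                  (solve 2 (λ a b → b := (a :- b) :* con 0ℚ :+ b) refl (ℕtoℚ a) (ℕtoℚ b)))
    where open +-*-Solver

  indTranslate-sub-isEigenvector : ∀ S W a b → IsPerfectSet S W a b →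
    ∀ z₁ z₀ → IsEigenvector S (ℕtoℚ a - ℕtoℚ b) (indTranslate W z₁ -ᵛ indTranslate W z₀)
  indTranslate-sub-isEigenvector S W a b perfect z₁ z₀ =
    IsAffineEigenvector-sub (A S) (ℕtoℚ a - ℕtoℚ b) (ℕtoℚ b)
      (indTranslate-affineEigenvector S W a b perfect z₁)
      (indTranslate-affineEigenvector S W a b perfect z₀)

corollary3p7 : (n : ℕ) (G : FinAbelianGroup n) (S : Fin n → Bool) →
    Cayley.InverseClosed G S → Cayley.Generates G S →
    S (FinAbelianGroup.ε G) ≡ false →
    (W₁ : Fin n → Bool) (a b : ℕ) →
    a < count n S → 1 ≤ b → b ≤ count n S →
    Cayley.IsPerfectSet G S W₁ a b →
    (r : ℕ) → IsRank (Cayley.indTranslate G W₁) r →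
    Cayley.MultiplicityAtLeast G S (ℕtoℚ a - ℕtoℚ b) (r ∸ 1)
corollary3p7 n G S _ _ _ W₁ a b _ _ _ _ zero _ = (λ ()) , (λ _ _ ()) , (λ ())
corollary3p7 n G S _ _ _ W₁ a b _ _ _ perfect (suc m) ((z , _ , indep) , _) =
  (λ i → v (suc i) -ᵛ v zero) ,
  LinIndep-differences v indep ,
  (λ i → indTranslate-sub-isEigenvector G S W₁ a b perfect (z (suc i)) (z zero))
  where
  v : Fin (suc m) → Vecℚ n
  v i = Cayley.indTranslate G W₁ (z i)
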